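{- Let $a,b$ be integers with $a-1>b\ge 1$, let $\varphi(0)=0^a1$, $\varphi(1)=0^b1$, let $u_\beta=\lim_{n\to\infty}\varphi^n(0)$, let $T(w)=0^b1\varphi(w)0^b$, and define $V^{(1)}=0^b$, $V^{(n)}=T(V^{(n-1)})$ for $n\ge2$. (i) If $b$ is even, then for all $n\in\mathbb N$, $V^{(n)}$ is a central factor of $V^{(n+2)}$; moreover $V^{(2n)}$ has center $1$ and $V^{(2n-1)}$ has center $\varepsilon$. (ii) If $b$ is odd and $a$ is even, then for all $n\in\mathbb N$, $V^{(n)}$ is a central factor of $V^{(n+3)}$; moreover $V^{(3n)}$ has center $1$, $V^{(3n-1)}$ has center $\varepsilon$, and $V^{(3n-2)}$ has center $0$. (iii) If $a$ and $b$ are both odd, then for all $n\in\mathbb N$, $V^{(n)}$ is a central factor of $V^{(n+1)}$ and has center $0$.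
   Context: Here $\mathbb N$ denotes the positive integers. Each $V^{(n)}$ is a palindrome (a word equal to its reversal) occurring in $u_\beta$. A palindrome $q$ is a central factor of a palindrome $p$ if $p=wq\overline{w}$ for a finite factor $w$ of $u_\beta$, where $\overline{w}$ is the reversal of $w$. The center of a palindrome of odd length is the letter $z$ with $p=wz\overline w$; the center of a palindrome of even length is the empty word $\varepsilon$. -}

module Defs where

open import Data.Nat using (ℕ; zero; suc)
open import Data.List using (List; []; _∷_; _++_; replicate; concatMap; reverse; take; drop; length)
open import Data.Product using (Σ; ∃; _×_)
open import Relation.Binary.PropositionalEquality using (_≡_)

data Letter : Set where
  𝟘 𝟙 : Letter

Word : Set
Word = List Letter

φL : ℕ → ℕ → Letter → Word
φL a b 𝟘 = replicate a 𝟘 ++ (𝟙 ∷ [])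
φL a b 𝟙 = replicate b 𝟘 ++ (𝟙 ∷ [])

φ : ℕ → ℕ → Word → Word
φ a b = concatMap (φL a b)

φ^ : ℕ → ℕ → ℕ → Word → Word
φ^ a b zero    w = w
φ^ a b (suc n) w = φ a b (φ^ a b n w)

-- i-th letter of a word (with default 𝟘 when out of range)
nth : ℕ → Word → Letter
nth _       []      = 𝟘
nth zero    (x ∷ _) = x
nth (suc i) (_ ∷ w) = nth i w

-- u_β = lim φ^n(0): its i-th letter is the i-th letter of φ^(i+1)(0)
-- (for a ≥ 2 the words φ^n(0) are nested prefixes with |φ^(i+1)(0)| > i)
u : ℕ → ℕ → ℕ → Letter
u a b i = nth i (φ^ a b (suc i) (𝟘 ∷ []))

uFactor : ℕ → ℕ → ℕ → ℕ → Word
uFactor a b i zero    = []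
uFactor a b i (suc n) = u a b i ∷ uFactor a b (suc i) n

IsFactor : ℕ → ℕ → Word → Set
IsFactor a b w = ∃ λ i → w ≡ uFactor a b i (length w)

CentralFactor : ℕ → ℕ → Word → Word → Set
CentralFactor a b q p = Σ Word λ w → IsFactor a b w × (p ≡ w ++ q ++ reverse w)

-- palindrome p has center c (c = [] for ε, c = z ∷ [] for a letter z)
HasCenter : Word → Word → Set
HasCenter p c = Σ Word λ w → p ≡ w ++ c ++ reverse w

T : ℕ → ℕ → Word → Word
T a b w = replicate b 𝟘 ++ (𝟙 ∷ []) ++ φ a b w ++ replicate b 𝟘

-- V a b n = V^(n); V^(0) is unused (set to ε), V^(1) = 0^b, V^(n) = T(V^(n-1))
V : ℕ → ℕ → ℕ → Word
V a b zero          = []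
V a b (suc zero)    = replicate b 𝟘
V a b (suc (suc n)) = T a b (V a b (suc n))

{-# OPTIONS --safe #-}
module Submission where

-- Write V^(n) = h c h̄ with a centre c ∈ {0, 00, 1}. As reverse(φ w) 1 = 1 φ(w̄), we get
-- T(h c h̄) = H X H̄ with H = 0^b 1 φ(h) whenever φ(c) = X 1, and for c = 0, 00, 1 the word
-- X = 0^a, 0^a 1 0^a, 0^b is again of the form z c' z̄ with z a block of zeros. So the
-- centres run through a cycle fixed by the parities of a and b while the halves grow by
-- prepending: once the centre returns after k steps, V^(n+k) = w V^(n) w̄. The word w is
-- a factor of u_β since every V^(n) occurs in some φ^m(0): T sends an occurrence in
-- φ^m(0) with nonempty context on both sides to an occurrence in φ^(m+1)(0).

open import Level using (Level)
open import Function using (_∘_)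
open import Data.Nat using (ℕ; zero; suc; _+_; _*_; _∸_; _<_; _≤_; _≤′_; ≤′-refl; ≤′-step; z≤n; s≤s; pred; ⌊_/2⌋)
open import Data.Nat.Properties
  using (≤-refl; ≤-trans; ≤-total; <⇒≤; ≤-<-trans; n≤1+n; m≤m+n; +-comm; +-assoc; +-identityʳ;
         *-suc; *-zeroʳ; m+[n∸m]≡n; m∸n+n≡m; ⌊n/2⌋-mono; ⌊n/2⌋≤n; pred-mono-≤; pred[n]≤n; ≤⇒≤′)
open import Data.Nat.Divisibility using (_∣_; ∣-refl; _∣0; ∣1⇒≡1; ∣m∣n⇒∣m+n; ∣m+n∣m⇒∣n)
open import Data.List using (List; []; _∷_; [_]; _++_; _∷ʳ_; replicate; reverse; length)
open import Data.List.Properties using (++-assoc; ++-identityʳ; reverse-++; unfold-reverse; concatMap-++; length-++; ++-monoid)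
open import Data.Product using (_×_; ∃; ∃₂; _,_)
open import Data.Sum using (inj₁; inj₂)
open import Relation.Nullary using (¬_; contradiction)
open import Relation.Binary.PropositionalEquality using (_≡_; refl; sym; trans; cong; cong₂; subst; subst₂; module ≡-Reasoning)
open import Defs
open import Algebra.Solver.Monoid (++-monoid Letter) using (solve; _⊕_; _⊜_)

open ≡-Reasoning

private
  variable
    ℓ : Level
    A : Set ℓ

replicate-+ : ∀ m n (x : A) → replicate (m + n) x ≡ replicate m x ++ replicate n x
replicate-+ zero    n x = refl
replicate-+ (suc m) n x = cong (x ∷_) (replicate-+ m n x)

replicate-+-∸ : ∀ {m n} (x : A) → m ≤ n → replicate n x ≡ replicate m x ++ replicate (n ∸ m) x
replicate-+-∸ {m = m} {n} x m≤n =
  trans (cong (λ k → replicate k x) (sym (m+[n∸m]≡n m≤n))) (replicate-+ m (n ∸ m) x)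

replicate-∸-+ : ∀ {m n} (x : A) → m ≤ n → replicate n x ≡ replicate (n ∸ m) x ++ replicate m x
replicate-∸-+ {m = m} {n} x m≤n =
  trans (cong (λ k → replicate k x) (sym (m∸n+n≡m m≤n))) (replicate-+ (n ∸ m) m x)

replicate-∷ʳ : ∀ n (x : A) → replicate n x ∷ʳ x ≡ x ∷ replicate n x
replicate-∷ʳ zero    x = refl
replicate-∷ʳ (suc n) x = cong (x ∷_) (replicate-∷ʳ n x)

reverse-replicate : ∀ n (x : A) → reverse (replicate n x) ≡ replicate n x
reverse-replicate zero    x = refl
reverse-replicate (suc n) x = begin
  reverse (x ∷ replicate n x)  ≡⟨ unfold-reverse x (replicate n x) ⟩
  reverse (replicate n x) ∷ʳ x ≡⟨ cong (_∷ʳ x) (reverse-replicate n x) ⟩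
  replicate n x ∷ʳ x           ≡⟨ replicate-∷ʳ n x ⟩
  x ∷ replicate n x            ∎

reverse-replicate-∷ʳ : ∀ n (x y : A) → reverse (replicate n x ∷ʳ y) ≡ y ∷ replicate n x
reverse-replicate-∷ʳ n x y = trans (reverse-++ (replicate n x) [ y ]) (cong (y ∷_) (reverse-replicate n x))

NonEmpty : List A → Set _
NonEmpty xs = ∃₂ λ y ys → xs ≡ y ∷ ys

++-nonEmptyˡ : ∀ {xs : List A} ys → NonEmpty xs → NonEmpty (xs ++ ys)
++-nonEmptyˡ ys (y , ys′ , refl) = y , ys′ ++ ys , refl

++-nonEmptyʳ : ∀ (xs : List A) {ys} → NonEmpty ys → NonEmpty (xs ++ ys)
++-nonEmptyʳ []       ys≢[] = ys≢[]
++-nonEmptyʳ (x ∷ xs) _     = x , xs ++ _ , refl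

length-<-++ : ∀ (xs : List A) {ys} → NonEmpty ys → length xs < length (xs ++ ys)
length-<-++ []       (y , ys , refl) = s≤s z≤n
length-<-++ (x ∷ xs) ys≢[]           = s≤s (length-<-++ xs ys≢[])

wrap : List A → List A → List A
wrap h c = h ++ c ++ reverse h

wrap-++ : ∀ (h z c : List A) → wrap (h ++ z) c ≡ wrap h (wrap z c)
wrap-++ h z c = begin
  (h ++ z) ++ c ++ reverse (h ++ z)         ≡⟨ cong (λ t → (h ++ z) ++ c ++ t) (reverse-++ h z) ⟩
  (h ++ z) ++ c ++ reverse z ++ reverse h   ≡⟨ ++-assoc h z _ ⟩
  h ++ z ++ c ++ reverse z ++ reverse h     ≡⟨ cong (λ t → h ++ z ++ t) (sym (++-assoc c (reverse z) _)) ⟩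
  h ++ z ++ (c ++ reverse z) ++ reverse h   ≡⟨ cong (h ++_) (sym (++-assoc z _ (reverse h))) ⟩
  h ++ (z ++ c ++ reverse z) ++ reverse h   ∎

nth-++ˡ : ∀ {i} (x s : Word) → i < length x → nth i (x ++ s) ≡ nth i x
nth-++ˡ {zero}  (c ∷ x) s _         = refl
nth-++ˡ {suc i} (c ∷ x) s (s≤s i<x) = nth-++ˡ x s i<x

nth-length-++ : ∀ (p : Word) c r → nth (length p) (p ++ c ∷ r) ≡ c
nth-length-++ []      c r = refl
nth-length-++ (_ ∷ p) c r = nth-length-++ p c r

𝟘^_ : ℕ → Word
𝟘^ n = replicate n 𝟘

-- ⟨𝟘𝟘⟩ stands for the empty centre together with one 𝟘 taken from each side of it:
-- unlike ε, the word 𝟘𝟘 is sent by φ to a palindrome around a new centre followed by 𝟙.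
data Centre : Set where
  ⟨𝟘⟩ ⟨𝟘𝟘⟩ ⟨𝟙⟩ : Centre

⟦_⟧ : Centre → Word
⟦ ⟨𝟘⟩  ⟧ = [ 𝟘 ]
⟦ ⟨𝟘𝟘⟩ ⟧ = 𝟘 ∷ 𝟘 ∷ []
⟦ ⟨𝟙⟩  ⟧ = [ 𝟙 ]

centre : Centre → Word
centre ⟨𝟘⟩  = [ 𝟘 ]
centre ⟨𝟘𝟘⟩ = []
centre ⟨𝟙⟩  = [ 𝟙 ]

wrap-hasCenter : ∀ h c → HasCenter (wrap h ⟦ c ⟧) (centre c)
wrap-hasCenter h ⟨𝟘⟩  = h , refl
wrap-hasCenter h ⟨𝟘𝟘⟩ = h ++ [ 𝟘 ] , sym (wrap-++ h [ 𝟘 ] [])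
wrap-hasCenter h ⟨𝟙⟩  = h , refl

𝟘^-centre : ℕ → Centre
𝟘^-centre zero          = ⟨𝟘𝟘⟩
𝟘^-centre (suc zero)    = ⟨𝟘⟩
𝟘^-centre (suc (suc n)) = 𝟘^-centre n

𝟘^-wrap : ∀ {n} → 1 ≤ n → 𝟘^ n ≡ wrap (𝟘^ ⌊ pred n /2⌋) ⟦ 𝟘^-centre n ⟧
𝟘^-wrap {1}                 _ = refl
𝟘^-wrap {2}                 _ = refl
𝟘^-wrap {suc (suc (suc n))} _ = begin
  𝟘 ∷ 𝟘^ suc (suc n)                                   ≡⟨ cong (𝟘 ∷_) (sym (replicate-∷ʳ (suc n) 𝟘)) ⟩
  𝟘 ∷ (𝟘^ suc n ∷ʳ 𝟘)                                  ≡⟨ cong (λ t → 𝟘 ∷ (t ∷ʳ 𝟘)) (𝟘^-wrap {suc n} (s≤s z≤n)) ⟩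
  wrap [ 𝟘 ] (wrap (𝟘^ ⌊ n /2⌋) ⟦ 𝟘^-centre (suc n) ⟧)   ≡⟨ sym (wrap-++ [ 𝟘 ] (𝟘^ ⌊ n /2⌋) _) ⟩
  wrap (𝟘^ suc ⌊ n /2⌋) ⟦ 𝟘^-centre (suc n) ⟧          ∎

𝟘^-centre-even : ∀ {n} → 2 ∣ n → 𝟘^-centre n ≡ ⟨𝟘𝟘⟩
𝟘^-centre-even {zero}        _     = refl
𝟘^-centre-even {suc zero}    2∣1   = contradiction (∣1⇒≡1 2∣1) λ ()
𝟘^-centre-even {suc (suc n)} 2∣2+n = 𝟘^-centre-even (∣m+n∣m⇒∣n 2∣2+n ∣-refl)

𝟘^-centre-odd : ∀ {n} → ¬ 2 ∣ n → 𝟘^-centre n ≡ ⟨𝟘⟩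
𝟘^-centre-odd {zero}        2∤0   = contradiction (2 ∣0) 2∤0
𝟘^-centre-odd {suc zero}    _     = refl
𝟘^-centre-odd {suc (suc n)} 2∤2+n = 𝟘^-centre-odd (2∤2+n ∘ ∣m∣n⇒∣m+n ∣-refl)

module _ (a b : ℕ) where

  φ-++ : ∀ xs ys → φ a b (xs ++ ys) ≡ φ a b xs ++ φ a b ys
  φ-++ = concatMap-++ (φL a b)

  φ^-++ : ∀ n xs ys → φ^ a b n (xs ++ ys) ≡ φ^ a b n xs ++ φ^ a b n ys
  φ^-++ zero    xs ys = refl
  φ^-++ (suc n) xs ys = trans (cong (φ a b) (φ^-++ n xs ys)) (φ-++ (φ^ a b n xs) (φ^ a b n ys))

  φ^-φ : ∀ n w → φ^ a b n (φ a b w) ≡ φ a b (φ^ a b n w)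
  φ^-φ zero    w = refl
  φ^-φ (suc n) w = cong (φ a b) (φ^-φ n w)

  φ-nonEmpty : ∀ {w} → NonEmpty w → NonEmpty (φ a b w)
  φ-nonEmpty (𝟘 , w , refl) = ++-nonEmptyˡ (φ a b w) (++-nonEmptyʳ (𝟘^ a) (𝟙 , [] , refl))
  φ-nonEmpty (𝟙 , w , refl) = ++-nonEmptyˡ (φ a b w) (++-nonEmptyʳ (𝟘^ b) (𝟙 , [] , refl))

  φ^-nonEmpty : ∀ n {w} → NonEmpty w → NonEmpty (φ^ a b n w)
  φ^-nonEmpty zero    w≢[] = w≢[]
  φ^-nonEmpty (suc n) w≢[] = φ-nonEmpty (φ^-nonEmpty n w≢[])

  reverse-φL : ∀ c → reverse (φL a b c) ++ [ 𝟙 ] ≡ 𝟙 ∷ φL a b c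
  reverse-φL 𝟘 = cong (_++ [ 𝟙 ]) (reverse-replicate-∷ʳ a 𝟘 𝟙)
  reverse-φL 𝟙 = cong (_++ [ 𝟙 ]) (reverse-replicate-∷ʳ b 𝟘 𝟙)

  reverse-φ : ∀ w → reverse (φ a b w) ++ [ 𝟙 ] ≡ 𝟙 ∷ φ a b (reverse w)
  reverse-φ []      = refl
  reverse-φ (c ∷ w) = begin
    reverse (φL a b c ++ φ a b w) ++ [ 𝟙 ]             ≡⟨ cong (_++ [ 𝟙 ]) (reverse-++ (φL a b c) (φ a b w)) ⟩
    (reverse (φ a b w) ++ reverse (φL a b c)) ++ [ 𝟙 ] ≡⟨ ++-assoc (reverse (φ a b w)) _ [ 𝟙 ] ⟩
    reverse (φ a b w) ++ reverse (φL a b c) ++ [ 𝟙 ]   ≡⟨ cong (reverse (φ a b w) ++_) (reverse-φL c) ⟩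
    reverse (φ a b w) ++ 𝟙 ∷ φL a b c                  ≡⟨ sym (++-assoc (reverse (φ a b w)) [ 𝟙 ] (φL a b c)) ⟩
    (reverse (φ a b w) ++ [ 𝟙 ]) ++ φL a b c           ≡⟨ cong (_++ φL a b c) (reverse-φ w) ⟩
    𝟙 ∷ φ a b (reverse w) ++ φL a b c                  ≡⟨ cong (λ t → 𝟙 ∷ φ a b (reverse w) ++ t) (sym (++-identityʳ (φL a b c))) ⟩
    𝟙 ∷ φ a b (reverse w) ++ φ a b [ c ]               ≡⟨ cong (𝟙 ∷_) (sym (φ-++ (reverse w) [ c ])) ⟩
    𝟙 ∷ φ a b (reverse w ∷ʳ c)                         ≡⟨ cong (λ t → 𝟙 ∷ φ a b t) (sym (unfold-reverse c w)) ⟩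
    𝟙 ∷ φ a b (reverse (c ∷ w))                        ∎

  Tˡ : Word → Word
  Tˡ h = 𝟘^ b ++ 𝟙 ∷ φ a b h

  reverse-Tˡ : ∀ h → reverse (Tˡ h) ≡ 𝟙 ∷ φ a b (reverse h) ++ 𝟘^ b
  reverse-Tˡ h = begin
    reverse (𝟘^ b ++ 𝟙 ∷ φ a b h)            ≡⟨ reverse-++ (𝟘^ b) (𝟙 ∷ φ a b h) ⟩
    reverse (𝟙 ∷ φ a b h) ++ reverse (𝟘^ b)  ≡⟨ cong₂ _++_ (trans (unfold-reverse 𝟙 (φ a b h)) (reverse-φ h)) (reverse-replicate b 𝟘) ⟩
    (𝟙 ∷ φ a b (reverse h)) ++ 𝟘^ b          ∎

  T-wrap : ∀ h c X → φ a b c ≡ X ++ [ 𝟙 ] → T a b (wrap h c) ≡ wrap (Tˡ h) X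
  T-wrap h c X φc≡X𝟙 = begin
    𝟘^ b ++ 𝟙 ∷ φ a b (h ++ c ++ reverse h) ++ 𝟘^ b
      ≡⟨ cong (λ t → 𝟘^ b ++ 𝟙 ∷ t ++ 𝟘^ b) (trans (φ-++ h _) (cong (φ a b h ++_) (φ-++ c (reverse h)))) ⟩
    𝟘^ b ++ 𝟙 ∷ (φ a b h ++ φ a b c ++ φ a b (reverse h)) ++ 𝟘^ b
      ≡⟨ cong (λ t → 𝟘^ b ++ 𝟙 ∷ (φ a b h ++ t ++ φ a b (reverse h)) ++ 𝟘^ b) φc≡X𝟙 ⟩
    𝟘^ b ++ 𝟙 ∷ (φ a b h ++ (X ++ [ 𝟙 ]) ++ φ a b (reverse h)) ++ 𝟘^ b
      ≡⟨ solve 5 (λ B Φ X o Φ̄ → B ⊕ (o ⊕ ((Φ ⊕ ((X ⊕ o) ⊕ Φ̄)) ⊕ B)) ⊜ (B ⊕ (o ⊕ Φ)) ⊕ (X ⊕ ((o ⊕ Φ̄) ⊕ B)))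
                 refl (𝟘^ b) (φ a b h) X [ 𝟙 ] (φ a b (reverse h)) ⟩
    Tˡ h ++ X ++ 𝟙 ∷ φ a b (reverse h) ++ 𝟘^ b
      ≡⟨ cong (λ t → Tˡ h ++ X ++ t) (sym (reverse-Tˡ h)) ⟩
    wrap (Tˡ h) X ∎

  P : ℕ → Word
  P n = φ^ a b n [ 𝟘 ]

  P-nonEmpty : ∀ n → NonEmpty (P n)
  P-nonEmpty n = φ^-nonEmpty n (𝟘 , [] , refl)

  Occurs : Word → Set
  Occurs w = ∃ λ n → ∃₂ λ p s → P n ≡ p ++ w ++ s

  OccursInside : Word → Set
  OccursInside w = ∃ λ n → ∃₂ λ p s → NonEmpty p × NonEmpty s × P n ≡ p ++ w ++ s

  Occurs-++ˡ : ∀ x y → Occurs (x ++ y) → Occurs x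
  Occurs-++ˡ x y (n , p , s , eq) = n , p , y ++ s , trans eq (cong (p ++_) (++-assoc x y s))

  φ𝟘-tail : Word
  φ𝟘-tail = 𝟘^ (a ∸ 2) ++ [ 𝟙 ]

  φ-𝟘 : 2 ≤ a → φ a b [ 𝟘 ] ≡ 𝟘 ∷ 𝟘 ∷ φ𝟘-tail
  φ-𝟘 (s≤s (s≤s _)) = ++-identityʳ (φL a b 𝟘)

  module _ (2≤a : 2 ≤ a) where

    P-suc : ∀ n → P (suc n) ≡ P n ++ P n ++ φ^ a b n φ𝟘-tail
    P-suc n = begin
      φ a b (P n)                           ≡⟨ sym (φ^-φ n [ 𝟘 ]) ⟩
      φ^ a b n (φ a b [ 𝟘 ])                ≡⟨ cong (φ^ a b n) (φ-𝟘 2≤a) ⟩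
      φ^ a b n ([ 𝟘 ] ++ [ 𝟘 ] ++ φ𝟘-tail)  ≡⟨ φ^-++ n [ 𝟘 ] ([ 𝟘 ] ++ φ𝟘-tail) ⟩
      P n ++ φ^ a b n ([ 𝟘 ] ++ φ𝟘-tail)    ≡⟨ cong (P n ++_) (φ^-++ n [ 𝟘 ] φ𝟘-tail) ⟩
      P n ++ P n ++ φ^ a b n φ𝟘-tail        ∎

    P-prefix : ∀ {m n} → m ≤′ n → ∃ λ s → P n ≡ P m ++ s
    P-prefix ≤′-refl = [] , sym (++-identityʳ _)
    P-prefix {m} (≤′-step {n} m≤n) with P-prefix m≤n
    ... | s , Pn≡Pm++s = s ++ P n ++ S , (begin
      P (suc n)              ≡⟨ P-suc n ⟩
      P n ++ P n ++ S        ≡⟨ cong (_++ P n ++ S) Pn≡Pm++s ⟩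
      (P m ++ s) ++ P n ++ S ≡⟨ ++-assoc (P m) s _ ⟩
      P m ++ s ++ P n ++ S   ∎)
      where S = φ^ a b n φ𝟘-tail

    nth-P : ∀ {i} m n → i < length (P m) → m ≤ n → nth i (P n) ≡ nth i (P m)
    nth-P {i} m n i<∣Pm∣ m≤n with P-prefix (≤⇒≤′ m≤n)
    ... | s , Pn≡Pm++s = trans (cong (nth i) Pn≡Pm++s) (nth-++ˡ (P m) s i<∣Pm∣)

    length-P : ∀ n → n < length (P n)
    length-P zero    = s≤s z≤n
    length-P (suc n) =
      subst (suc n <_) (sym (cong length (P-suc n)))
        (≤-<-trans (length-P n) (length-<-++ (P n) (++-nonEmptyˡ _ (P-nonEmpty n))))

    u-nth : ∀ {i} n → i < length (P n) → u a b i ≡ nth i (P n)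
    u-nth {i} n i<∣Pn∣ with ≤-total n (suc i)
    ... | inj₁ n≤1+i = nth-P n (suc i) i<∣Pn∣ n≤1+i
    ... | inj₂ 1+i≤n = sym (nth-P (suc i) n (≤-trans (n≤1+n (suc i)) (length-P (suc i))) 1+i≤n)

    occurrence⇒uFactor : ∀ n p w s → P n ≡ p ++ w ++ s → w ≡ uFactor a b (length p) (length w)
    occurrence⇒uFactor n p []      s _  = refl
    occurrence⇒uFactor n p (c ∷ w) s eq = cong₂ _∷_ c≡u w≡uFactor
      where
        p<∣Pn∣ : length p < length (P n)
        p<∣Pn∣ = subst (λ t → length p < length t) (sym eq) (length-<-++ p (c , w ++ s , refl))

        c≡u : c ≡ u a b (length p)
        c≡u = begin
          c                                ≡⟨ sym (nth-length-++ p c (w ++ s)) ⟩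
          nth (length p) (p ++ c ∷ w ++ s) ≡⟨ cong (nth (length p)) (sym eq) ⟩
          nth (length p) (P n)             ≡⟨ sym (u-nth n p<∣Pn∣) ⟩
          u a b (length p)                 ∎

        w≡uFactor : w ≡ uFactor a b (suc (length p)) (length w)
        w≡uFactor = subst (λ i → w ≡ uFactor a b i (length w)) (trans (length-++ p) (+-comm (length p) 1))
          (occurrence⇒uFactor n (p ∷ʳ c) w s (trans eq (sym (++-assoc p [ c ] (w ++ s)))))

    Occurs⇒IsFactor : ∀ {w} → Occurs w → IsFactor a b w
    Occurs⇒IsFactor {w} (n , p , s , eq) = length p , occurrence⇒uFactor n p w s eq

    Occurs-wrap⇒CentralFactor : ∀ h q → Occurs (wrap h q) → CentralFactor a b q (wrap h q)
    Occurs-wrap⇒CentralFactor h q occ = h , Occurs⇒IsFactor (Occurs-++ˡ h _ occ) , refl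

    -- An occurrence in P n recurs in the second copy of P n inside P (suc n).
    Occurs⇒OccursInside : ∀ {w} → Occurs w → OccursInside w
    Occurs⇒OccursInside {w} (n , p , s , Pn≡pws) =
      suc n , P n ++ p , s ++ S ,
      ++-nonEmptyˡ p (P-nonEmpty n) , ++-nonEmptyʳ s (φ^-nonEmpty n (++-nonEmptyʳ (𝟘^ (a ∸ 2)) (𝟙 , [] , refl))) ,
      (begin
        P (suc n)                  ≡⟨ P-suc n ⟩
        P n ++ P n ++ S            ≡⟨ cong (λ t → P n ++ t ++ S) Pn≡pws ⟩
        P n ++ (p ++ w ++ s) ++ S  ≡⟨ solve 5 (λ x p w s S → x ⊕ ((p ⊕ (w ⊕ s)) ⊕ S) ⊜ (x ⊕ p) ⊕ (w ⊕ (s ⊕ S))) refl (P n) p w s S ⟩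
        (P n ++ p) ++ w ++ s ++ S  ∎)
      where S = φ^ a b n φ𝟘-tail

  exponent : Letter → ℕ
  exponent 𝟘 = a
  exponent 𝟙 = b

  φL-exponent : ∀ c → φL a b c ≡ 𝟘^ exponent c ++ [ 𝟙 ]
  φL-exponent 𝟘 = refl
  φL-exponent 𝟙 = refl

  module _ (b≤a : b ≤ a) where

    b≤exponent : ∀ c → b ≤ exponent c
    b≤exponent 𝟘 = b≤a
    b≤exponent 𝟙 = ≤-refl

    φL-starts : ∀ c → ∃ λ r → φL a b c ≡ 𝟘^ b ++ r
    φL-starts c = 𝟘^ (exponent c ∸ b) ++ [ 𝟙 ] , (begin
      φL a b c                                 ≡⟨ φL-exponent c ⟩
      𝟘^ exponent c ++ [ 𝟙 ]                   ≡⟨ cong (_++ [ 𝟙 ]) (replicate-+-∸ 𝟘 (b≤exponent c)) ⟩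
      (𝟘^ b ++ 𝟘^ (exponent c ∸ b)) ++ [ 𝟙 ]   ≡⟨ ++-assoc (𝟘^ b) _ [ 𝟙 ] ⟩
      𝟘^ b ++ 𝟘^ (exponent c ∸ b) ++ [ 𝟙 ]     ∎)

    φL-ends : ∀ c → ∃ λ q → φL a b c ≡ q ++ 𝟘^ b ++ [ 𝟙 ]
    φL-ends c = 𝟘^ (exponent c ∸ b) , (begin
      φL a b c                                 ≡⟨ φL-exponent c ⟩
      𝟘^ exponent c ++ [ 𝟙 ]                   ≡⟨ cong (_++ [ 𝟙 ]) (replicate-∸-+ 𝟘 (b≤exponent c)) ⟩
      (𝟘^ (exponent c ∸ b) ++ 𝟘^ b) ++ [ 𝟙 ]   ≡⟨ ++-assoc (𝟘^ (exponent c ∸ b)) _ [ 𝟙 ] ⟩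
      𝟘^ (exponent c ∸ b) ++ 𝟘^ b ++ [ 𝟙 ]     ∎)

    φ-starts : ∀ c w → ∃ λ r → φ a b (c ∷ w) ≡ 𝟘^ b ++ r
    φ-starts c w with φL-starts c
    ... | r , eq = r ++ φ a b w , trans (cong (_++ φ a b w) eq) (++-assoc (𝟘^ b) r _)

    φ-ends : ∀ c w → ∃ λ q → φ a b (c ∷ w) ≡ q ++ 𝟘^ b ++ [ 𝟙 ]
    φ-ends c []       with φL-ends c
    ... | q , eq = q , trans (++-identityʳ (φL a b c)) eq
    φ-ends c (c′ ∷ w) with φ-ends c′ w
    ... | q , eq = φL a b c ++ q , trans (cong (φL a b c ++_) eq) (sym (++-assoc (φL a b c) q _))

    OccursInside⇒Occurs-T : ∀ {w} → OccursInside w → Occurs (T a b w)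
    OccursInside⇒Occurs-T {w} (n , _ , _ , (c , p , refl) , (c′ , s , refl) , Pn≡pws)
      with φ-ends c p | φ-starts c′ s
    ... | q , φp≡q0ᵇ1 | r , φs≡0ᵇr = suc n , q , r , (begin
      φ a b (P n)                                                 ≡⟨ cong (φ a b) Pn≡pws ⟩
      φ a b (c ∷ p ++ w ++ c′ ∷ s)                                ≡⟨ φ-++ (c ∷ p) _ ⟩
      φ a b (c ∷ p) ++ φ a b (w ++ c′ ∷ s)                        ≡⟨ cong (φ a b (c ∷ p) ++_) (φ-++ w (c′ ∷ s)) ⟩
      φ a b (c ∷ p) ++ φ a b w ++ φ a b (c′ ∷ s)                  ≡⟨ cong₂ (λ x y → x ++ φ a b w ++ y) φp≡q0ᵇ1 φs≡0ᵇr ⟩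
      (q ++ 𝟘^ b ++ [ 𝟙 ]) ++ φ a b w ++ 𝟘^ b ++ r                ≡⟨ solve 5 (λ q B o Φ r → (q ⊕ (B ⊕ o)) ⊕ (Φ ⊕ (B ⊕ r)) ⊜ q ⊕ ((B ⊕ (o ⊕ (Φ ⊕ B))) ⊕ r))
                                                                          refl q (𝟘^ b) [ 𝟙 ] (φ a b w) r ⟩
      q ++ T a b w ++ r                                           ∎)

    Tˡ-++ : ∀ {W} h → NonEmpty W → ∃ λ W′ → NonEmpty W′ × Tˡ (W ++ h) ≡ W′ ++ Tˡ h
    Tˡ-++ h (c , W , refl) with φ-ends c W
    ... | q , φW≡q0ᵇ1 = 𝟘^ b ++ 𝟙 ∷ q , ++-nonEmptyʳ (𝟘^ b) (𝟙 , q , refl) , (begin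
      𝟘^ b ++ 𝟙 ∷ φ a b (c ∷ W ++ h)                 ≡⟨ cong (λ t → 𝟘^ b ++ 𝟙 ∷ t) (φ-++ (c ∷ W) h) ⟩
      𝟘^ b ++ 𝟙 ∷ φ a b (c ∷ W) ++ φ a b h           ≡⟨ cong (λ t → 𝟘^ b ++ 𝟙 ∷ t ++ φ a b h) φW≡q0ᵇ1 ⟩
      𝟘^ b ++ 𝟙 ∷ (q ++ 𝟘^ b ++ [ 𝟙 ]) ++ φ a b h    ≡⟨ solve 4 (λ B o q Φ → B ⊕ (o ⊕ ((q ⊕ (B ⊕ o)) ⊕ Φ)) ⊜ (B ⊕ (o ⊕ q)) ⊕ (B ⊕ (o ⊕ Φ)))
                                                           refl (𝟘^ b) [ 𝟙 ] q (φ a b h) ⟩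
      (𝟘^ b ++ 𝟙 ∷ q) ++ Tˡ h                        ∎)

  next : Centre → Centre
  next ⟨𝟘⟩  = 𝟘^-centre a
  next ⟨𝟘𝟘⟩ = ⟨𝟙⟩
  next ⟨𝟙⟩  = 𝟘^-centre b

  margin : Centre → ℕ
  margin ⟨𝟘⟩  = ⌊ pred a /2⌋
  margin ⟨𝟘𝟘⟩ = a
  margin ⟨𝟙⟩  = ⌊ pred b /2⌋

  centres : ℕ → Centre
  centres zero    = 𝟘^-centre b
  centres (suc n) = next (centres n)

  half : ℕ → Word
  half zero    = 𝟘^ margin ⟨𝟙⟩
  half (suc n) = Tˡ (half n) ++ 𝟘^ margin (centres n)

  centres-+ : ∀ {k} → centres k ≡ centres 0 → ∀ n → centres (n + k) ≡ centres n
  centres-+ period zero    = period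
  centres-+ period (suc n) = cong next (centres-+ period n)

  centres-+-* : ∀ k → centres k ≡ centres 0 → ∀ r m → centres (r + k * m) ≡ centres r
  centres-+-* k period r zero    = cong centres (trans (cong (r +_) (*-zeroʳ k)) (+-identityʳ r))
  centres-+-* k period r (suc m) = begin
    centres (r + k * suc m) ≡⟨ cong centres r+k*[1+m]≡r+k*m+k ⟩
    centres (r + k * m + k) ≡⟨ centres-+ period (r + k * m) ⟩
    centres (r + k * m)     ≡⟨ centres-+-* k period r m ⟩
    centres r               ∎
    where
      r+k*[1+m]≡r+k*m+k : r + k * suc m ≡ r + k * m + k
      r+k*[1+m]≡r+k*m+k = trans (cong (r +_) (trans (*-suc k m) (+-comm k (k * m)))) (sym (+-assoc r (k * m) k))

  module _ (b≤a : b ≤ a) where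

    margin-≥ : ∀ c → margin ⟨𝟙⟩ ≤ margin c
    margin-≥ ⟨𝟘⟩  = ⌊n/2⌋-mono (pred-mono-≤ b≤a)
    margin-≥ ⟨𝟘𝟘⟩ = ≤-trans (⌊n/2⌋≤n (pred b)) (≤-trans pred[n]≤n b≤a)
    margin-≥ ⟨𝟙⟩  = ≤-refl

    half-suc : ∀ k → ∃ λ W → NonEmpty W × half (suc k) ≡ W ++ half 0
    half-suc k = Tˡ (half k) ++ 𝟘^ (m ∸ margin ⟨𝟙⟩) , ++-nonEmptyˡ _ (++-nonEmptyʳ (𝟘^ b) (𝟙 , _ , refl)) , (begin
      Tˡ (half k) ++ 𝟘^ m                                  ≡⟨ cong (Tˡ (half k) ++_) (replicate-∸-+ 𝟘 (margin-≥ (centres k))) ⟩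
      Tˡ (half k) ++ 𝟘^ (m ∸ margin ⟨𝟙⟩) ++ half 0         ≡⟨ sym (++-assoc (Tˡ (half k)) _ _) ⟩
      (Tˡ (half k) ++ 𝟘^ (m ∸ margin ⟨𝟙⟩)) ++ half 0       ∎)
      where m = margin (centres k)

    half-+ : ∀ {k} → centres (suc k) ≡ centres 0 → ∀ n → ∃ λ W → NonEmpty W × half (n + suc k) ≡ W ++ half n
    half-+ {k} _ zero = half-suc k
    half-+ {k} period (suc n) with half-+ period n
    ... | W , W≢[] , eq with Tˡ-++ b≤a (half n) W≢[]
    ...   | W′ , W′≢[] , eq′ = W′ , W′≢[] , (begin
      Tˡ (half (n + suc k)) ++ 𝟘^ margin (centres (n + suc k)) ≡⟨ cong₂ (λ h c → Tˡ h ++ 𝟘^ margin c) eq (centres-+ period n) ⟩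
      Tˡ (W ++ half n) ++ 𝟘^ margin (centres n)                ≡⟨ cong (_++ 𝟘^ margin (centres n)) eq′ ⟩
      (W′ ++ Tˡ (half n)) ++ 𝟘^ margin (centres n)             ≡⟨ ++-assoc W′ _ _ ⟩
      W′ ++ half (suc n)                                       ∎)

  module _ (1≤a : 1 ≤ a) (1≤b : 1 ≤ b) where

    φ-⟦⟧ : ∀ c → φ a b ⟦ c ⟧ ≡ wrap (𝟘^ margin c) ⟦ next c ⟧ ++ [ 𝟙 ]
    φ-⟦⟧ ⟨𝟘⟩  = trans (++-identityʳ (φL a b 𝟘)) (cong (_++ [ 𝟙 ]) (𝟘^-wrap 1≤a))
    φ-⟦⟧ ⟨𝟘𝟘⟩ = begin
      φL a b 𝟘 ++ φL a b 𝟘 ++ []             ≡⟨ cong (φL a b 𝟘 ++_) (++-identityʳ (φL a b 𝟘)) ⟩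
      (𝟘^ a ++ [ 𝟙 ]) ++ 𝟘^ a ++ [ 𝟙 ]       ≡⟨ sym (++-assoc (𝟘^ a ++ [ 𝟙 ]) (𝟘^ a) [ 𝟙 ]) ⟩
      ((𝟘^ a ++ [ 𝟙 ]) ++ 𝟘^ a) ++ [ 𝟙 ]     ≡⟨ cong (_++ [ 𝟙 ]) (++-assoc (𝟘^ a) [ 𝟙 ] (𝟘^ a)) ⟩
      (𝟘^ a ++ [ 𝟙 ] ++ 𝟘^ a) ++ [ 𝟙 ]       ≡⟨ cong (λ t → (𝟘^ a ++ [ 𝟙 ] ++ t) ++ [ 𝟙 ]) (sym (reverse-replicate a 𝟘)) ⟩
      wrap (𝟘^ a) [ 𝟙 ] ++ [ 𝟙 ]             ∎
    φ-⟦⟧ ⟨𝟙⟩  = trans (++-identityʳ (φL a b 𝟙)) (cong (_++ [ 𝟙 ]) (𝟘^-wrap 1≤b))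

    V-wrap : ∀ n → V a b (suc n) ≡ wrap (half n) ⟦ centres n ⟧
    V-wrap zero    = 𝟘^-wrap 1≤b
    V-wrap (suc n) = begin
      T a b (V a b (suc n))                                    ≡⟨ cong (T a b) (V-wrap n) ⟩
      T a b (wrap (half n) ⟦ c ⟧)                              ≡⟨ T-wrap (half n) ⟦ c ⟧ _ (φ-⟦⟧ c) ⟩
      wrap (Tˡ (half n)) (wrap (𝟘^ margin c) ⟦ next c ⟧)       ≡⟨ sym (wrap-++ (Tˡ (half n)) (𝟘^ margin c) _) ⟩
      wrap (half (suc n)) ⟦ centres (suc n) ⟧                  ∎
      where c = centres n

    V-hasCenter : ∀ {c} n → centres n ≡ c → HasCenter (V a b (suc n)) (centre c)
    V-hasCenter n cₙ≡c =
      subst₂ HasCenter (sym (V-wrap n)) (cong centre cₙ≡c) (wrap-hasCenter (half n) (centres n))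

  module _ (2≤a : 2 ≤ a) (b≤a : b ≤ a) (1≤b : 1 ≤ b) where

    1≤a : 1 ≤ a
    1≤a = ≤-trans (s≤s z≤n) 2≤a

    V-occurs : ∀ n → Occurs (V a b (suc n))
    V-occurs zero with φL-starts b≤a 𝟘
    ... | r , φL𝟘≡0ᵇr = 1 , [] , r , trans (++-identityʳ (φL a b 𝟘)) φL𝟘≡0ᵇr
    V-occurs (suc n) = OccursInside⇒Occurs-T b≤a (Occurs⇒OccursInside 2≤a (V-occurs n))

    V-centralFactor : ∀ {k} → centres (suc k) ≡ centres 0 →
                      (n : ℕ) → 1 ≤ n → CentralFactor a b (V a b n) (V a b (n + suc k))
    V-centralFactor {k} period (suc n) _ with half-+ b≤a period n
    ... | W , _ , half≡W++half =
      subst (CentralFactor a b (V a b (suc n))) (sym V≡wrap)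
        (Occurs-wrap⇒CentralFactor 2≤a W _ (subst Occurs V≡wrap (V-occurs (n + suc k))))
      where
        V≡wrap : V a b (suc (n + suc k)) ≡ wrap W (V a b (suc n))
        V≡wrap = begin
          V a b (suc (n + suc k))                              ≡⟨ V-wrap 1≤a 1≤b (n + suc k) ⟩
          wrap (half (n + suc k)) ⟦ centres (n + suc k) ⟧      ≡⟨ cong₂ (λ h c → wrap h ⟦ c ⟧) half≡W++half (centres-+ period n) ⟩
          wrap (W ++ half n) ⟦ centres n ⟧                     ≡⟨ wrap-++ W (half n) _ ⟩
          wrap W (wrap (half n) ⟦ centres n ⟧)                 ≡⟨ cong (wrap W) (sym (V-wrap 1≤a 1≤b n)) ⟩
          wrap W (V a b (suc n))                               ∎

    V-period-2 : 2 ∣ b →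
      ((n : ℕ) → 1 ≤ n → CentralFactor a b (V a b n) (V a b (n + 2)))
      × ((m : ℕ) → HasCenter (V a b (2 * suc m)) [ 𝟙 ] × HasCenter (V a b (2 * m + 1)) [])
    V-period-2 2∣b = V-centralFactor period , λ m →
      subst (λ i → HasCenter (V a b i) [ 𝟙 ]) (sym (*-suc 2 m))
        (V-hasCenter 1≤a 1≤b (1 + 2 * m) (trans (centres-+-* 2 period 1 m) (cong next c₀≡𝟘𝟘))) ,
      subst (λ i → HasCenter (V a b i) []) (+-comm 1 (2 * m))
        (V-hasCenter 1≤a 1≤b (2 * m) (trans (centres-+-* 2 period 0 m) c₀≡𝟘𝟘))
      where
        c₀≡𝟘𝟘 : centres 0 ≡ ⟨𝟘𝟘⟩
        c₀≡𝟘𝟘 = 𝟘^-centre-even 2∣b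

        period : centres 2 ≡ centres 0
        period = cong (next ∘ next) c₀≡𝟘𝟘

    V-period-3 : ¬ 2 ∣ b → 2 ∣ a →
      ((n : ℕ) → 1 ≤ n → CentralFactor a b (V a b n) (V a b (n + 3)))
      × ((m : ℕ) → HasCenter (V a b (3 * suc m)) [ 𝟙 ]
                 × HasCenter (V a b (3 * m + 2)) []
                 × HasCenter (V a b (3 * m + 1)) [ 𝟘 ])
    V-period-3 2∤b 2∣a = V-centralFactor period , λ m →
      subst (λ i → HasCenter (V a b i) [ 𝟙 ]) (sym (*-suc 3 m))
        (V-hasCenter 1≤a 1≤b (2 + 3 * m) (trans (centres-+-* 3 period 2 m) c₂≡𝟙)) ,
      subst (λ i → HasCenter (V a b i) []) (+-comm 2 (3 * m))
        (V-hasCenter 1≤a 1≤b (1 + 3 * m) (trans (centres-+-* 3 period 1 m) c₁≡𝟘𝟘)) ,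
      subst (λ i → HasCenter (V a b i) [ 𝟘 ]) (+-comm 1 (3 * m))
        (V-hasCenter 1≤a 1≤b (3 * m) (trans (centres-+-* 3 period 0 m) c₀≡𝟘))
      where
        c₀≡𝟘 : centres 0 ≡ ⟨𝟘⟩
        c₀≡𝟘 = 𝟘^-centre-odd 2∤b

        c₁≡𝟘𝟘 : centres 1 ≡ ⟨𝟘𝟘⟩
        c₁≡𝟘𝟘 = trans (cong next c₀≡𝟘) (𝟘^-centre-even 2∣a)

        c₂≡𝟙 : centres 2 ≡ ⟨𝟙⟩
        c₂≡𝟙 = cong next c₁≡𝟘𝟘

        period : centres 3 ≡ centres 0
        period = cong next c₂≡𝟙

    V-period-1 : ¬ 2 ∣ a → ¬ 2 ∣ b →
      (n : ℕ) → 1 ≤ n → CentralFactor a b (V a b n) (V a b (n + 1)) × HasCenter (V a b n) [ 𝟘 ]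
    V-period-1 2∤a 2∤b (suc n) 1≤1+n =
      V-centralFactor (trans (cₙ≡𝟘 1) (sym (cₙ≡𝟘 0))) (suc n) 1≤1+n , V-hasCenter 1≤a 1≤b n (cₙ≡𝟘 n)
      where
        cₙ≡𝟘 : ∀ n → centres n ≡ ⟨𝟘⟩
        cₙ≡𝟘 zero    = 𝟘^-centre-odd 2∤b
        cₙ≡𝟘 (suc n) = trans (cong next (cₙ≡𝟘 n)) (𝟘^-centre-odd 2∤a)

proposition5p12 : (a b : ℕ) → b + 1 < a → 1 ≤ b →
    ((2 ∣ b) →
      ((n : ℕ) → 1 ≤ n → CentralFactor a b (V a b n) (V a b (n + 2)))
      × ((m : ℕ) → HasCenter (V a b (2 * suc m)) (𝟙 ∷ [])
                 × HasCenter (V a b (2 * m + 1)) []))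
    × ((¬ (2 ∣ b)) → (2 ∣ a) →
      ((n : ℕ) → 1 ≤ n → CentralFactor a b (V a b n) (V a b (n + 3)))
      × ((m : ℕ) → HasCenter (V a b (3 * suc m)) (𝟙 ∷ [])
                 × HasCenter (V a b (3 * m + 2)) []
                 × HasCenter (V a b (3 * m + 1)) (𝟘 ∷ [])))
    × ((¬ (2 ∣ a)) → (¬ (2 ∣ b)) →
      ((n : ℕ) → 1 ≤ n → CentralFactor a b (V a b n) (V a b (n + 1))
                        × HasCenter (V a b n) (𝟘 ∷ [])))
proposition5p12 a b b+1<a 1≤b =
  V-period-2 a b 2≤a b≤a 1≤b , V-period-3 a b 2≤a b≤a 1≤b , V-period-1 a b 2≤a b≤a 1≤b
  where
    b≤a : b ≤ a
    b≤a = ≤-trans (m≤m+n b 1) (<⇒≤ b+1<a)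

    2≤a : 2 ≤ a
    2≤a = ≤-trans (m≤m+n 2 b) (subst (λ k → suc k ≤ a) (+-comm b 1) b+1<a)
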